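{- Let $(G,V_1,\dots,V_r,f)$ be an instance of \textsc{Chained Multicolored Clique}, and let $G'$ be its frame graph with the partition $\mathcal{P}$ of $V(G')$ as defined in the context. Then $G'$ has an independent set $S$ with $|S\cap P|=1$ for every $P\in\mathcal{P}$ if and only if $G$ has a chained multicolored clique.
   Context: An instance of \textsc{Chained Multicolored Clique} is a graph $G$, a partition of $V(G)$ into $V_1,\dots,V_r$ such that every edge $uv$ with $u\in V_i$, $v\in V_j$ has $|i-j|\le1$, and a function $f:V(G)\to[k]$. A chained multicolored clique is a set $W\subseteq V(G)$ such that $W\cap(V_i\cup V_{i+1})$ is a clique for each $i\in[r-1]$ and for each $i\in[r]$, $j\in[k]$ there is $v\in W\cap V_i$ with $f(v)=j$. Let $V(i,j)=\{v\in V_i: f(v)=j\}$. The subdivided bipartite complement between disjoint $A,B$: subdivide each edge between $A$ and $B$ by a new vertex (the new vertices form $R$), then replace the edges between $A$ and $R$ by the non-edges between them, and likewise between $B$ and $R$. The frame graph $G'$ is obtained from $G$ by applying, for each $h\in[r-1]$ and each pair $(i_1,j_1),(i_2,j_2)\in\{h,h+1\}\times[k]$ with $(i_1,j_1)<(i_2,j_2)$ lexicographically, the subdivided bipartite complement between $V(i_1,j_1)$ and $V(i_2,j_2)$; the new vertices so created form $R(i_1,j_1,i_2,j_2)$. $\mathcal{P}$ is the partition of $V(G')$ into all sets $V(i,j)$ and all sets $R(i_1,j_1,i_2,j_2)$. -}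

module Defs where

open import Data.Nat using (ℕ; suc; _≤_; _<_)
open import Data.Fin using (Fin; toℕ)
open import Data.Bool using (Bool; true)
open import Data.Product using (Σ; ∃; _×_; _,_)
open import Data.Sum using (_⊎_)
open import Data.Empty using (⊥)
open import Relation.Nullary using (¬_)
open import Relation.Binary.PropositionalEquality using (_≡_; _≢_)

record Graph (n : ℕ) : Set where
  field
    E     : Fin n → Fin n → Bool
    sym   : ∀ u v → E u v ≡ E v u
    irrefl : ∀ u → ¬ (E u u ≡ true)

  Adj : Fin n → Fin n → Set
  Adj u v = E u v ≡ true

-- An instance of Chained Multicolored Clique with parts V_1..V_r (indexed by
-- Fin r, 0-based) and colours [k] (indexed by Fin k).
record CMCInstance (n r k : ℕ) : Set where
  field
    G    : Graph n
    part : Fin n → Fin r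
    col  : Fin n → Fin k
    chain : ∀ u v → Graph.Adj G u v → toℕ (part u) ≤ suc (toℕ (part v))

module _ {n r k : ℕ} (I : CMCInstance n r k) where
  open CMCInstance I
  open Graph G

  cls : Fin n → Fin r × Fin k
  cls v = part v , col v

  InWindow : Fin r → Fin n → Set
  InWindow h v = toℕ (part v) ≡ toℕ h ⊎ toℕ (part v) ≡ suc (toℕ h)

  IsChainedMCClique : (Fin n → Bool) → Set
  IsChainedMCClique W =
    (∀ (h : Fin r) → suc (toℕ h) < r →
       ∀ u v → W u ≡ true → W v ≡ true → InWindow h u → InWindow h v →
       u ≢ v → Adj u v)
    × (∀ (i : Fin r) (j : Fin k) → ∃ λ v → W v ≡ true × part v ≡ i × col v ≡ j)

_<lex_ : ∀ {r k} → Fin r × Fin k → Fin r × Fin k → Set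
(i₁ , j₁) <lex (i₂ , j₂) = toℕ i₁ < toℕ i₂ ⊎ (i₁ ≡ i₂ × toℕ j₁ < toℕ j₂)

-- pairs of classes (i₁,j₁) < (i₂,j₂) that are treated in the frame graph,
-- i.e. both lie in {h,h+1} × [k] for some h ∈ [r-1]; under r ≥ 2 this is
-- exactly: lexicographically smaller and i₂ ≤ i₁ + 1.
Treated : ∀ {r k} → Fin r × Fin k → Fin r × Fin k → Set
Treated c₁@(i₁ , _) c₂@(i₂ , _) = c₁ <lex c₂ × toℕ i₂ ≤ suc (toℕ i₁)

module Frame {n r k : ℕ} (I : CMCInstance n r k) where
  open CMCInstance I
  open Graph G

  -- subdivision vertex for the edge uv, u ∈ V(i₁,j₁), v ∈ V(i₂,j₂), treated pair
  RVert : Fin n → Fin n → Set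
  RVert u v = Adj u v × Treated (cls I u) (cls I v)

  V' : Set
  V' = Fin n ⊎ Σ (Fin n × Fin n) (λ { (u , v) → RVert u v })

  open import Data.Sum using (inj₁; inj₂)

  AdjVR : Fin n → Fin n → Fin n → Set
  AdjVR x u v = (cls I x ≡ cls I u × x ≢ u) ⊎ (cls I x ≡ cls I v × x ≢ v)

  Adj' : V' → V' → Set
  Adj' (inj₁ x) (inj₁ y) =
    Adj x y × ¬ Treated (cls I x) (cls I y) × ¬ Treated (cls I y) (cls I x)
  Adj' (inj₁ x) (inj₂ ((u , v) , _)) = AdjVR x u v
  Adj' (inj₂ ((u , v) , _)) (inj₁ x) = AdjVR x u v
  Adj' (inj₂ _) (inj₂ _) = ⊥

  InV : Fin r × Fin k → V' → Set
  InV c (inj₁ x) = cls I x ≡ c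
  InV c (inj₂ _) = ⊥

  InR : Fin r × Fin k → Fin r × Fin k → V' → Set
  InR c₁ c₂ (inj₁ _) = ⊥
  InR c₁ c₂ (inj₂ ((u , v) , _)) = cls I u ≡ c₁ × cls I v ≡ c₂

  Independent : (V' → Bool) → Set
  Independent S = ∀ a b → S a ≡ true → S b ≡ true → ¬ Adj' a b

  ExactlyOne : (V' → Bool) → (V' → Set) → Set
  ExactlyOne S P = ∃ λ x → S x ≡ true × P x × (∀ y → S y ≡ true → P y → y ≡ x)

  Transversal : (V' → Bool) → Set
  Transversal S =
    (∀ c → ExactlyOne S (InV c))
    × (∀ c₁ c₂ → Treated c₁ c₂ → ExactlyOne S (InR c₁ c₂))

module Submission where

-- From a chained multicolored clique W, keep one representative of W per class V(i,j) and add
-- the subdivision vertices of the edges between representatives of treated pairs of classes.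
-- In G' an original vertex x sees the subdivision vertex of uv only if x shares a class with u
-- (or v) without being it, and two original vertices stay adjacent only inside a class, since
-- every other edge of G joins a treated pair; so this set is an independent transversal.
-- Conversely, independence forces the subdivision vertex that a transversal S picks in
-- R(c₁,c₂) to subdivide the edge between the picks of S in V(c₁) and V(c₂), which are thus
-- adjacent; any two classes meeting a window V_h ∪ V_{h+1} form a treated pair, so the
-- original vertices of S form a chained multicolored clique.

open import Defs
open import Axiom.UniquenessOfIdentityProofs.WithK using (uip)
open import Data.Bool using (Bool; true)
open import Data.Fin using (Fin; toℕ; fromℕ<)
open import Data.Fin.Properties using (toℕ<n; toℕ-fromℕ<)
  renaming (_≟_ to _≟ᶠ_; <-cmp to <ᶠ-cmp)
open import Data.Nat using (ℕ; zero; suc; _≤_; _<_; _<?_)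
open import Data.Nat.Properties
  using (≤-refl; n≤1+n; m≤n⇒m≤1+n; ≤-antisym; <-irrefl; <-irrelevant; ≤-irrelevant; <-trans; n<1+n)
open import Data.Product using (∃; _×_; _,_; proj₁; proj₂)
open import Data.Product.Properties using (≡-dec)
open import Data.Sum using (_⊎_; inj₁; inj₂; [_,_]′)
import Data.Sum as Sum
open import Data.Sum.Properties using (inj₁-injective)
open import Function.Base using (_∘_)
open import Function.Bundles using (_⇔_; mk⇔)
open import Relation.Binary.Definitions using (Irrelevant; DecidableEquality; tri<; tri≈; tri>)
open import Relation.Binary.PropositionalEquality
open import Relation.Nullary using (¬_; Dec; does; yes; no; contradiction; _×-dec_)
open import Relation.Nullary.Decidable using (dec-true; decidable-stable)

witness : ∀ {a} {A : Set a} (a? : Dec A) → does a? ≡ true → A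
witness (yes a) _ = a

module _ {n : ℕ} (G : Graph n) where
  open Graph G using (Adj) renaming (sym to E-sym)

  Adj-sym : ∀ {u v} → Adj u v → Adj v u
  Adj-sym {u} {v} uv = trans (E-sym v u) uv

module _ {r k : ℕ} where

  _≟ᶜ_ : DecidableEquality (Fin r × Fin k)
  _≟ᶜ_ = ≡-dec _≟ᶠ_ _≟ᶠ_

  <lex-irrelevant : Irrelevant (_<lex_ {r} {k})
  <lex-irrelevant (inj₁ p) (inj₁ q) = cong inj₁ (<-irrelevant p q)
  <lex-irrelevant (inj₁ p) (inj₂ (refl , _)) = contradiction p (<-irrefl refl)
  <lex-irrelevant (inj₂ (refl , _)) (inj₁ q) = contradiction q (<-irrefl refl)
  <lex-irrelevant (inj₂ (e , p)) (inj₂ (e′ , q)) =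
    cong₂ (λ e p → inj₂ (e , p)) (uip e e′) (<-irrelevant p q)

  <lex-irreflexive : ∀ {c : Fin r × Fin k} → ¬ (c <lex c)
  <lex-irreflexive (inj₁ lt) = <-irrefl refl lt
  <lex-irreflexive (inj₂ (_ , lt)) = <-irrefl refl lt

  <lex-connex : ∀ {c₁ c₂ : Fin r × Fin k} → c₁ ≢ c₂ → c₁ <lex c₂ ⊎ c₂ <lex c₁
  <lex-connex {i₁ , j₁} {i₂ , j₂} c₁≢c₂ with <ᶠ-cmp i₁ i₂
  ... | tri< lt _ _ = inj₁ (inj₁ lt)
  ... | tri> _ _ gt = inj₂ (inj₁ gt)
  ... | tri≈ _ refl _ with <ᶠ-cmp j₁ j₂
  ...   | tri< lt _ _ = inj₁ (inj₂ (refl , lt))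
  ...   | tri≈ _ refl _ = contradiction refl c₁≢c₂
  ...   | tri> _ _ gt = inj₂ (inj₂ (refl , gt))

  Treated-irrelevant : Irrelevant (Treated {r} {k})
  Treated-irrelevant (p , b) (q , b′) = cong₂ _,_ (<lex-irrelevant p q) (≤-irrelevant b b′)

  Treated-connex : ∀ {c₁ c₂ : Fin r × Fin k} → c₁ ≢ c₂ →
    toℕ (proj₁ c₂) ≤ suc (toℕ (proj₁ c₁)) → toℕ (proj₁ c₁) ≤ suc (toℕ (proj₁ c₂)) →
    Treated c₁ c₂ ⊎ Treated c₂ c₁
  Treated-connex c₁≢c₂ b₁ b₂ = Sum.map (_, b₁) (_, b₂) (<lex-connex c₁≢c₂)

-- InWindow I h v unfolds to Window (toℕ h) (toℕ (part v)).
Window : ℕ → ℕ → Set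
Window h a = a ≡ h ⊎ a ≡ suc h

window⇒≤1+ : ∀ {h a b} → Window h a → Window h b → a ≤ suc b
window⇒≤1+ {h} (inj₁ refl) (inj₁ refl) = n≤1+n h
window⇒≤1+ {h} (inj₁ refl) (inj₂ refl) = m≤n⇒m≤1+n (n≤1+n h)
window⇒≤1+ (inj₂ refl) (inj₁ refl) = ≤-refl
window⇒≤1+ {h} (inj₂ refl) (inj₂ refl) = n≤1+n (suc h)

Treated⇒consecutive : ∀ {r k} {c₁ c₂ : Fin r × Fin k} → Treated c₁ c₂ →
  Window (toℕ (proj₁ c₁)) (toℕ (proj₁ c₂))
Treated⇒consecutive (inj₁ lt , b) = inj₂ (≤-antisym b lt)
Treated⇒consecutive (inj₂ (refl , _) , _) = inj₁ refl

-- The window is {a, a+1} unless a is the last part, in which case it is {a-1, a}.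
consecutive⇒windowℕ : ∀ {r a b} → 1 < r → b < r → Window a b →
  ∃ λ h → suc h < r × Window h a × Window h b
consecutive⇒windowℕ {a = a} _ b<r (inj₂ refl) = a , b<r , inj₁ refl , inj₂ refl
consecutive⇒windowℕ {r} {a} 1<r a<r (inj₁ refl) with suc a <? r
... | yes 1+a<r = a , 1+a<r , inj₁ refl , inj₁ refl
consecutive⇒windowℕ {a = zero} 1<r _ (inj₁ refl) | no 1≮r = contradiction 1<r 1≮r
consecutive⇒windowℕ {a = suc m} _ a<r (inj₁ refl) | no _ = m , a<r , inj₂ refl , inj₂ refl

consecutive⇒window : ∀ {r} → 1 < r → (i₁ i₂ : Fin r) → Window (toℕ i₁) (toℕ i₂) →
  ∃ λ (h : Fin r) → suc (toℕ h) < r × Window (toℕ h) (toℕ i₁) × Window (toℕ h) (toℕ i₂)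
consecutive⇒window 1<r i₁ i₂ w with consecutive⇒windowℕ 1<r (toℕ<n i₂) w
... | m , 1+m<r , w₁ , w₂ with fromℕ< (<-trans (n<1+n m) 1+m<r)
                            | toℕ-fromℕ< (<-trans (n<1+n m) 1+m<r)
...   | h | refl = h , 1+m<r , w₁ , w₂

module _ {n r k : ℕ} (I : CMCInstance n r k) where
  open CMCInstance I
  open Graph G using (Adj; irrefl)
  open Frame I

  frame-edge⇒same-class : ∀ {x y} → Adj' (inj₁ x) (inj₁ y) → cls I x ≡ cls I y
  frame-edge⇒same-class {x} {y} (xy , ¬t₁ , ¬t₂) =
    decidable-stable (cls I x ≟ᶜ cls I y) λ c≢ →
      [ ¬t₁ , ¬t₂ ]′ (Treated-connex c≢ (chain y x (Adj-sym G xy)) (chain x y xy))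

  subdivision-vertex-≡ : ∀ {u v u′ v′} (p : RVert u v) (q : RVert u′ v′) →
    u ≡ u′ → v ≡ v′ → _≡_ {A = V'} (inj₂ ((u , v) , p)) (inj₂ ((u′ , v′) , q))
  subdivision-vertex-≡ (uv , t) (uv′ , t′) refl refl =
    cong₂ (λ a b → inj₂ (_ , a , b)) (uip uv uv′) (Treated-irrelevant t t′)

  module CliqueToTransversal (1<r : 1 < r) (W : Fin n → Bool) (cl : IsChainedMCClique I W) where

    rep : Fin r × Fin k → Fin n
    rep (i , j) = proj₁ (proj₂ cl i j)

    rep-∈W : ∀ c → W (rep c) ≡ true
    rep-∈W (i , j) = proj₁ (proj₂ (proj₂ cl i j))

    cls-rep : ∀ c → cls I (rep c) ≡ c
    cls-rep (i , j) with proj₂ cl i j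
    ... | _ , _ , refl , refl = refl

    rep-adjacent : ∀ c₁ c₂ → Treated c₁ c₂ → Adj (rep c₁) (rep c₂)
    rep-adjacent c₁ c₂ t
      with consecutive⇒window 1<r (proj₁ c₁) (proj₁ c₂) (Treated⇒consecutive t)
    ... | h , 1+h<r , w₁ , w₂ =
      proj₁ cl h 1+h<r (rep c₁) (rep c₂) (rep-∈W c₁) (rep-∈W c₂)
        (subst (Window (toℕ h) ∘ toℕ) (sym (cong proj₁ (cls-rep c₁))) w₁)
        (subst (Window (toℕ h) ∘ toℕ) (sym (cong proj₁ (cls-rep c₂))) w₂)
        λ e → <lex-irreflexive (proj₁ (subst (Treated c₁) (sym (rep-injective e)) t))
      where
      rep-injective : rep c₁ ≡ rep c₂ → c₁ ≡ c₂
      rep-injective e = trans (sym (cls-rep c₁)) (trans (cong (cls I) e) (cls-rep c₂))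

    Chosen : Fin n → Set
    Chosen x = rep (cls I x) ≡ x

    chosen? : ∀ x → Dec (Chosen x)
    chosen? x = rep (cls I x) ≟ᶠ x

    rep-chosen : ∀ c → Chosen (rep c)
    rep-chosen c = cong rep (cls-rep c)

    chosen⇒rep : ∀ {x c} → Chosen x → cls I x ≡ c → x ≡ rep c
    chosen⇒rep x✓ refl = sym x✓

    chosen-unique : ∀ {x y} → Chosen x → Chosen y → cls I x ≡ cls I y → x ≡ y
    chosen-unique x✓ y✓ e = trans (chosen⇒rep x✓ e) y✓

    S : V' → Bool
    S (inj₁ x) = does (chosen? x)
    S (inj₂ ((u , v) , _)) = does (chosen? u ×-dec chosen? v)

    ¬AdjVR-chosen : ∀ {x u v} → Chosen x → Chosen u → Chosen v → ¬ AdjVR x u v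
    ¬AdjVR-chosen x✓ u✓ v✓ (inj₁ (e , x≢u)) = x≢u (chosen-unique x✓ u✓ e)
    ¬AdjVR-chosen x✓ u✓ v✓ (inj₂ (e , x≢v)) = x≢v (chosen-unique x✓ v✓ e)

    independent : Independent S
    independent (inj₁ x) (inj₁ y) x∈S y∈S xy =
      irrefl y (subst (λ z → Adj z y) x≡y (proj₁ xy))
      where
      x≡y = chosen-unique (witness (chosen? x) x∈S) (witness (chosen? y) y∈S)
                          (frame-edge⇒same-class xy)
    independent (inj₁ x) (inj₂ ((u , v) , _)) x∈S uv∈S
      with u✓ , v✓ ← witness (chosen? u ×-dec chosen? v) uv∈S =
      ¬AdjVR-chosen (witness (chosen? x) x∈S) u✓ v✓
    independent (inj₂ ((u , v) , _)) (inj₁ x) uv∈S x∈S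
      with u✓ , v✓ ← witness (chosen? u ×-dec chosen? v) uv∈S =
      ¬AdjVR-chosen (witness (chosen? x) x∈S) u✓ v✓
    independent (inj₂ _) (inj₂ _) _ _ ()

    exactly-one-in-class : ∀ c → ExactlyOne S (InV c)
    exactly-one-in-class c =
      inj₁ (rep c) , dec-true (chosen? (rep c)) (rep-chosen c) , cls-rep c , unique
      where
      unique : ∀ y → S y ≡ true → InV c y → y ≡ inj₁ (rep c)
      unique (inj₁ y) y∈S e = cong inj₁ (chosen⇒rep (witness (chosen? y) y∈S) e)

    exactly-one-subdivision : ∀ c₁ c₂ → Treated c₁ c₂ → ExactlyOne S (InR c₁ c₂)
    exactly-one-subdivision c₁ c₂ t =
      inj₂ ((rep c₁ , rep c₂) , rep-edge) ,
      dec-true (chosen? (rep c₁) ×-dec chosen? (rep c₂)) (rep-chosen c₁ , rep-chosen c₂) ,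
      (cls-rep c₁ , cls-rep c₂) , unique
      where
      rep-edge : RVert (rep c₁) (rep c₂)
      rep-edge = rep-adjacent c₁ c₂ t , subst₂ Treated (sym (cls-rep c₁)) (sym (cls-rep c₂)) t
      unique : ∀ y → S y ≡ true → InR c₁ c₂ y → y ≡ inj₂ ((rep c₁ , rep c₂) , rep-edge)
      unique (inj₂ ((u , v) , p)) uv∈S (e₁ , e₂)
        with u✓ , v✓ ← witness (chosen? u ×-dec chosen? v) uv∈S =
        subdivision-vertex-≡ p rep-edge (chosen⇒rep u✓ e₁) (chosen⇒rep v✓ e₂)

    transversal : Transversal S
    transversal = exactly-one-in-class , exactly-one-subdivision

  module TransversalToClique (S : V' → Bool) (independent : Independent S)
                             (transversal : Transversal S) where

    W : Fin n → Bool
    W x = S (inj₁ x)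

    W-class-unique : ∀ {u v} → W u ≡ true → W v ≡ true → cls I u ≡ cls I v → u ≡ v
    W-class-unique {u} {v} u∈W v∈W e with proj₁ transversal (cls I u)
    ... | _ , _ , _ , unique =
      inj₁-injective (trans (unique (inj₁ u) u∈W refl) (sym (unique (inj₁ v) v∈W (sym e))))

    module _ {a b} {p : RVert a b} (ab∈S : S (inj₂ ((a , b) , p)) ≡ true) where

      W⇒first-endpoint : ∀ {x} → W x ≡ true → cls I x ≡ cls I a → x ≡ a
      W⇒first-endpoint {x} x∈W e =
        decidable-stable (x ≟ᶠ a) λ x≢a → independent _ _ x∈W ab∈S (inj₁ (e , x≢a))

      W⇒second-endpoint : ∀ {x} → W x ≡ true → cls I x ≡ cls I b → x ≡ b
      W⇒second-endpoint {x} x∈W e =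
        decidable-stable (x ≟ᶠ b) λ x≢b → independent _ _ x∈W ab∈S (inj₂ (e , x≢b))

    treated⇒adjacent : ∀ {u v} → Treated (cls I u) (cls I v) → W u ≡ true → W v ≡ true → Adj u v
    treated⇒adjacent {u} {v} t u∈W v∈W with proj₂ transversal (cls I u) (cls I v) t
    ... | inj₂ ((a , b) , ab , _) , ab∈S , (ea , eb) , _
      with refl ← W⇒first-endpoint ab∈S u∈W (sym ea)
         | refl ← W⇒second-endpoint ab∈S v∈W (sym eb) = ab

    is-clique : IsChainedMCClique I W
    is-clique = window-clique , colourful
      where
      window-clique : ∀ h → suc (toℕ h) < r → ∀ u v → W u ≡ true → W v ≡ true →
        InWindow I h u → InWindow I h v → u ≢ v → Adj u v
      window-clique h _ u v u∈W v∈W wu wv u≢v with cls I u ≟ᶜ cls I v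
      ... | yes e = contradiction (W-class-unique u∈W v∈W e) u≢v
      ... | no c≢ with Treated-connex c≢ (window⇒≤1+ wv wu) (window⇒≤1+ wu wv)
      ...   | inj₁ t = treated⇒adjacent t u∈W v∈W
      ...   | inj₂ t = Adj-sym G (treated⇒adjacent t v∈W u∈W)

      colourful : ∀ i j → ∃ λ v → W v ≡ true × part v ≡ i × col v ≡ j
      colourful i j with proj₁ transversal (i , j)
      ... | inj₁ x , x∈W , refl , _ = x , x∈W , refl , refl

lemma24 : ∀ {n r k : ℕ} → 1 < r → (I : CMCInstance n r k) →
          (∃ λ (S : Frame.V' I → Bool) → Frame.Independent I S × Frame.Transversal I S)
          ⇔ (∃ λ (W : Fin n → Bool) → IsChainedMCClique I W)
lemma24 1<r I = mk⇔
  (λ (S , independent , transversal) → let open TransversalToClique I S independent transversal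
                                         in W , is-clique)
  (λ (W , cl) → let open CliqueToTransversal I 1<r W cl in S , independent , transversal)
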